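{- For all $n\ge1$, \[\sum_{D\in\mathcal{D}_n}\prod_{i=1}^{n-1}\binom{r_i(D)+s_i(D)}{r_i(D)}=\frac{1}{2n+1}\binom{3n}{n},\] where $\mathcal{D}_n$ is the set of Dyck words on $\{x,y\}$ of semilength $n$, $r_i(D)$ is the number of $y$'s between the $i$-th and $(i+1)$-st $x$ of $D$, and $s_i(D)$ is the number of $x$'s between the $i$-th and $(i+1)$-st $y$ of $D$.
   Context: A Dyck word on $\{x,y\}$ of semilength $n$ is a word with $n$ $x$'s and $n$ $y$'s in which every prefix contains at least as many $x$'s as $y$'s. -}

module Defs where

open import Data.Nat using (ℕ; zero; suc; _+_; _*_; _≤ᵇ_; _≡ᵇ_)
open import Data.Nat.Combinatorics using (_C_)
open import Data.List using (List; []; _∷_; concatMap; filterᵇ; zipWith; map; inits)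
open import Data.Nat.ListAction using (sum; product)
open import Data.Bool.ListAction using (all)
open import Data.Bool using (Bool; true; false; _∧_)

data Letter : Set where
  x y : Letter

Word : Set
Word = List Letter

count : Letter → Word → ℕ
count _ [] = 0
count x (x ∷ w) = suc (count x w)
count x (y ∷ w) = count x w
count y (x ∷ w) = count y w
count y (y ∷ w) = suc (count y w)

words : ℕ → List Word
words zero = [] ∷ []
words (suc k) = concatMap (λ w → (x ∷ w) ∷ (y ∷ w) ∷ []) (words k)

isDyckᵇ : ℕ → Word → Bool
isDyckᵇ n w = (count x w ≡ᵇ n) ∧ (count y w ≡ᵇ n)
              ∧ all (λ u → count y u ≤ᵇ count x u) (inits w)

Dyck : ℕ → List Word
Dyck n = filterᵇ (isDyckᵇ n) (words (n + n))

-- gaps a w : for consecutive occurrences of letter a in w, the number of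
-- letters (necessarily the other letter) strictly between the i-th and
-- (i+1)-st occurrence of a, for i = 1, …, (#a − 1).
-- gapsFrom a c w : we have seen an occurrence of a, and c other letters since.
gapsFrom : Letter → ℕ → Word → List ℕ
gapsFrom a c [] = []
gapsFrom x c (x ∷ w) = c ∷ gapsFrom x 0 w
gapsFrom x c (y ∷ w) = gapsFrom x (suc c) w
gapsFrom y c (y ∷ w) = c ∷ gapsFrom y 0 w
gapsFrom y c (x ∷ w) = gapsFrom y (suc c) w

gaps : Letter → Word → List ℕ
gaps a [] = []
gaps x (x ∷ w) = gapsFrom x 0 w
gaps x (y ∷ w) = gaps x w
gaps y (y ∷ w) = gapsFrom y 0 w
gaps y (x ∷ w) = gaps y w

r : Word → List ℕ
r = gaps x

s : Word → List ℕ
s = gaps y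

weight : Word → ℕ
weight D = product (zipWith (λ ri si → (ri + si) C ri) (r D) (s D))

-- Read a Dyck word from left to right. After j y's and k x's the pairs (r_i, s_i) with i < j
-- are complete, s_j is being read, and the gaps r_{j+1}, …, r_k (the last one still growing)
-- wait for their partners. Each x read extends s_j by one, and the hockey-stick identity
-- C(p + s + 1, p) = Σ_{q ≤ p} C(q + s, q) trades the factor C(r_j + s_j, r_j) for a sum over a
-- parameter q ≤ r_j that takes over the role of r_j. After this bookkeeping, the total weight
-- of all completions of a reading state with X x's still to come depends only on X and on
-- W = 1 + p + 2·(number of waiting gaps) + (sum of waiting gaps), where p is the current
-- stand-in for r_j, and it satisfies T(0, W) = 1, T(X+1, 0) = 0 and
-- T(X+1, W+1) = T(X, W+3) + T(X+1, W). These are the ternary ballot numbers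
-- T(X, W) = W/(W+3X)·C(W+3X, X), and the sum over 𝒟ₙ is T(n, 1) = C(3n, n)/(2n+1).

module Submission where

open import Defs
open import Data.Bool using (Bool; true; false; _∧_; if_then_else_)
open import Data.Bool.ListAction using (all; and)
open import Data.Bool.Properties using (∧-zeroʳ)
open import Data.Empty using (⊥-elim)
open import Data.List.Base using (module Inits)
open import Data.List using (List; []; _∷_; _++_; map; zipWith; inits; length; filterᵇ; concatMap)
open import Data.List.Properties using (map-cong; map-∘; length-++; ++-assoc; zipWith-zeroʳ)
open import Data.Nat using (ℕ; zero; suc; pred; _+_; _*_; _≥_; _≡ᵇ_; _≤ᵇ_; _<ᵇ_)
open import Data.Nat.Combinatorics using (_C_; nCn≡1; nC1≡n; nCk+nC[k+1]≡[n+1]C[k+1])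
open import Data.Nat.DivMod using (_/_; m*n/n≡m)
open import Data.Nat.ListAction using (sum; product)
open import Data.Nat.ListAction.Properties using (sum-++)
open import Data.Nat.Properties
open import Algebra.Properties.CommutativeSemigroup +-commutativeSemigroup
  using (interchange; x∙yz≈yx∙z)
open import Algebra.Properties.CommutativeSemigroup *-commutativeSemigroup
  using () renaming (x∙yz≈y∙xz to *-leftComm)
open import Data.Nat.Tactic.RingSolver using (solve; solve-∀)
open import Data.Product using (∃-syntax; _×_; _,_; proj₁; proj₂)
open import Relation.Binary.PropositionalEquality
open ≡-Reasoning

[k+1]*[n+1]C[k+1]≡[n+1]*nCk : ∀ n k → suc k * (suc n C suc k) ≡ suc n * (n C k)
[k+1]*[n+1]C[k+1]≡[n+1]*nCk zero    zero    = refl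
[k+1]*[n+1]C[k+1]≡[n+1]*nCk zero    (suc k) = *-zeroʳ (suc (suc k))
[k+1]*[n+1]C[k+1]≡[n+1]*nCk (suc n) zero    =
  trans (*-identityˡ _) (trans (nC1≡n (suc (suc n))) (sym (*-identityʳ _)))
[k+1]*[n+1]C[k+1]≡[n+1]*nCk (suc n) (suc k) = begin
  suc (suc k) * (suc (suc n) C suc (suc k))
    ≡⟨ cong (suc (suc k) *_) (sym (nCk+nC[k+1]≡[n+1]C[k+1] (suc n) (suc k))) ⟩
  suc (suc k) * (a + b)
    ≡⟨ trans (*-distribˡ-+ (suc (suc k)) a b) (+-assoc a _ _) ⟩
  a + (suc k * a + suc (suc k) * b)
    ≡⟨ cong₂ (λ u v → a + (u + v)) ([k+1]*[n+1]C[k+1]≡[n+1]*nCk n k)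
                                   ([k+1]*[n+1]C[k+1]≡[n+1]*nCk n (suc k)) ⟩
  a + (suc n * (n C k) + suc n * (n C suc k))
    ≡⟨ cong (a +_) (sym (*-distribˡ-+ (suc n) (n C k) (n C suc k))) ⟩
  a + suc n * (n C k + n C suc k)
    ≡⟨ cong (λ c → a + suc n * c) (nCk+nC[k+1]≡[n+1]C[k+1] n k) ⟩
  suc (suc n) * a ∎
  where
  a = suc n C suc k
  b = suc n C suc (suc k)

[j+1]*[k+j+1]Ck≡[k+j+1]*[k+j]Ck : ∀ k j → suc j * (suc (k + j) C k) ≡ suc (k + j) * ((k + j) C k)
[j+1]*[k+j+1]Ck≡[k+j+1]*[k+j]Ck zero    j = refl
[j+1]*[k+j+1]Ck≡[k+j+1]*[k+j]Ck (suc k) j = +-cancelʳ-≡ (suc k * e) _ _ (begin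
  suc j * e + suc k * e         ≡⟨ sym (*-distribʳ-+ e (suc j) (suc k)) ⟩
  (suc j + suc k) * e           ≡⟨ cong (_* e) (+-comm (suc j) (suc k)) ⟩
  (suc k + suc j) * e           ≡⟨ cong (λ m → suc m * e) (+-suc k j) ⟩
  suc N * e                     ≡⟨ cong (suc N *_) (sym (nCk+nC[k+1]≡[n+1]C[k+1] N k)) ⟩
  suc N * (a + b)               ≡⟨ *-distribˡ-+ (suc N) a b ⟩
  suc N * a + suc N * b         ≡⟨ +-comm (suc N * a) _ ⟩
  suc N * b + suc N * a         ≡⟨ cong (suc N * b +_) (sym ([k+1]*[n+1]C[k+1]≡[n+1]*nCk N k)) ⟩
  suc N * b + suc k * e         ∎)
  where
  N = suc k + j
  e = suc N C suc k
  a = N C k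
  b = N C suc k

sumUpTo : ℕ → (ℕ → ℕ) → ℕ
sumUpTo zero    f = f 0
sumUpTo (suc n) f = sumUpTo n f + f (suc n)

sumUpTo-cong : ∀ n {f g : ℕ → ℕ} → (∀ i → f i ≡ g i) → sumUpTo n f ≡ sumUpTo n g
sumUpTo-cong zero    f≗g = f≗g 0
sumUpTo-cong (suc n) f≗g = cong₂ _+_ (sumUpTo-cong n f≗g) (f≗g (suc n))

sumUpTo-0 : ∀ n → sumUpTo n (λ _ → 0) ≡ 0
sumUpTo-0 zero    = refl
sumUpTo-0 (suc n) = cong (_+ 0) (sumUpTo-0 n)

sumUpTo-distribʳ : ∀ n f c → sumUpTo n (λ i → f i * c) ≡ sumUpTo n f * c
sumUpTo-distribʳ zero    f c = refl
sumUpTo-distribʳ (suc n) f c =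
  trans (cong (_+ f (suc n) * c) (sumUpTo-distribʳ n f c)) (sym (*-distribʳ-+ c (sumUpTo n f) _))

sumUpTo-if : ∀ n b (f : ℕ → ℕ) →
  sumUpTo n (λ i → if b then f i else 0) ≡ (if b then sumUpTo n f else 0)
sumUpTo-if n true  f = refl
sumUpTo-if n false f = sumUpTo-0 n

if-congᵗ : ∀ b {m n : ℕ} → (b ≡ true → m ≡ n) → (if b then m else 0) ≡ (if b then n else 0)
if-congᵗ true  m≡n = m≡n refl
if-congᵗ false m≡n = refl

module _ {A : Set} where

  sum-map-+ : ∀ (f g : A → ℕ) xs → sum (map (λ a → f a + g a) xs) ≡ sum (map f xs) + sum (map g xs)
  sum-map-+ f g []       = refl
  sum-map-+ f g (a ∷ xs) =
    trans (cong (f a + g a +_) (sum-map-+ f g xs)) (interchange (f a) (g a) _ _)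

  sum-map-0 : ∀ (xs : List A) → sum (map (λ _ → 0) xs) ≡ 0
  sum-map-0 []       = refl
  sum-map-0 (_ ∷ xs) = sum-map-0 xs

  sum-map-sumUpTo : ∀ n (f : ℕ → A → ℕ) xs →
    sum (map (λ a → sumUpTo n (λ i → f i a)) xs) ≡ sumUpTo n (λ i → sum (map (f i) xs))
  sum-map-sumUpTo zero    f xs = refl
  sum-map-sumUpTo (suc n) f xs =
    trans (sum-map-+ (λ a → sumUpTo n (λ i → f i a)) (f (suc n)) xs)
          (cong (_+ sum (map (f (suc n)) xs)) (sum-map-sumUpTo n f xs))

  sum-filterᵇ : ∀ (P : A → Bool) (f : A → ℕ) xs →
    sum (map f (filterᵇ P xs)) ≡ sum (map (λ a → if P a then f a else 0) xs)
  sum-filterᵇ P f []       = refl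
  sum-filterᵇ P f (a ∷ xs) with P a
  ... | true  = cong (f a +_) (sum-filterᵇ P f xs)
  ... | false = sum-filterᵇ P f xs

  all-inits-∷ : ∀ (P : List A → Bool) a w →
    all P (inits (a ∷ w)) ≡ P [] ∧ all (λ u → P (a ∷ u)) (inits w)
  all-inits-∷ P a w = cong (λ z → P [] ∧ (P (a ∷ []) ∧ and z)) (sym (map-∘ (Inits.tail w)))

sum-words-suc : ∀ k (f : Word → ℕ) →
  sum (map f (words (suc k))) ≡
  sum (map (λ w → f (x ∷ w)) (words k)) + sum (map (λ w → f (y ∷ w)) (words k))
sum-words-suc k f = trans (sum-concatMap (words k)) (sum-map-+ _ _ (words k))
  where
  sum-concatMap : ∀ ws → sum (map f (concatMap (λ w → (x ∷ w) ∷ (y ∷ w) ∷ []) ws)) ≡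
                         sum (map (λ w → f (x ∷ w) + f (y ∷ w)) ws)
  sum-concatMap []       = refl
  sum-concatMap (w ∷ ws) =
    trans (sym (+-assoc (f (x ∷ w)) (f (y ∷ w)) _))
          (cong (f (x ∷ w) + f (y ∷ w) +_) (sum-concatMap ws))

ballot : ℕ → ℕ → ℕ
ballot zero    _       = 1
ballot (suc u) zero    = 0
ballot (suc u) (suc h) = ballot u (3 + h) + ballot (suc u) h

ballot-unfold : ∀ u m p →
  ballot (suc u) (suc (p + m)) ≡ sumUpTo p (λ q → ballot u (3 + q + m)) + ballot (suc u) m
ballot-unfold u m zero    = refl
ballot-unfold u m (suc p) =
  trans (cong (ballot u (3 + suc p + m) +_) (ballot-unfold u m p))
        (x∙yz≈yx∙z (ballot u (3 + suc p + m)) (sumUpTo p (λ q → ballot u (3 + q + m))) (ballot (suc u) m))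

ballot-step : ∀ u t {b₁ b₂ a c} →
  (3 + t + 3 * u) * b₁ ≡ (3 + t) * a →
  (3 + t + 3 * u) * b₂ ≡ t * c →
  suc u * (a + c) ≡ (4 + t + 3 * u) * a →
  (4 + t + 3 * u) * (b₁ + b₂) ≡ suc t * (a + c)
ballot-step u t {b₁} {b₂} {a} {c} h₁ h₂ h₃ = *-cancelˡ-≡ _ _ (suc u * (3 + t + 3 * u)) (begin
  suc u * (3 + t + 3 * u) * ((4 + t + 3 * u) * (b₁ + b₂))
    ≡⟨ solve (u ∷ t ∷ b₁ ∷ b₂ ∷ []) ⟩
  (4 + t + 3 * u) * (suc u * ((3 + t + 3 * u) * b₁) + suc u * ((3 + t + 3 * u) * b₂))
    ≡⟨ cong₂ (λ v w → (4 + t + 3 * u) * (suc u * v + suc u * w)) h₁ h₂ ⟩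
  (4 + t + 3 * u) * (suc u * ((3 + t) * a) + suc u * (t * c))
    ≡⟨ solve (u ∷ t ∷ a ∷ c ∷ []) ⟩
  (4 + t + 3 * u) * (3 * (suc u * a) + t * (suc u * (a + c)))
    ≡⟨ cong (λ v → (4 + t + 3 * u) * (3 * (suc u * a) + t * v)) h₃ ⟩
  (4 + t + 3 * u) * (3 * (suc u * a) + t * ((4 + t + 3 * u) * a))
    ≡⟨ solve (u ∷ t ∷ a ∷ []) ⟩
  (3 + t + 3 * u) * (suc t * ((4 + t + 3 * u) * a))
    ≡⟨ cong (λ v → (3 + t + 3 * u) * (suc t * v)) (sym h₃) ⟩
  (3 + t + 3 * u) * (suc t * (suc u * (a + c)))
    ≡⟨ solve (u ∷ t ∷ a ∷ c ∷ []) ⟩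
  suc u * (3 + t + 3 * u) * (suc t * (a + c)) ∎)

ballot-closed : ∀ u h → (h + 3 * u) * ballot u h ≡ h * ((h + 3 * u) C u)
ballot-closed zero    h       = cong (_* 1) (+-identityʳ h)
ballot-closed (suc u) zero    = *-zeroʳ (3 * suc u)
ballot-closed (suc u) (suc t) =
  subst (λ N → suc N * (b₁ + b₂) ≡ suc t * (suc N C suc u)) (sym N≡)
    (trans (ballot-step u t {b₁} {b₂} {N C u} {N C suc u} (ballot-closed u (3 + t))
                            (subst (λ N → N * b₂ ≡ t * (N C suc u)) N≡ (ballot-closed (suc u) t))
                            (trans (cong (suc u *_) (nCk+nC[k+1]≡[n+1]C[k+1] N u))
                                   ([k+1]*[n+1]C[k+1]≡[n+1]*nCk N u)))
           (cong (suc t *_) (nCk+nC[k+1]≡[n+1]C[k+1] N u)))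
  where
  b₁ = ballot u (3 + t)
  b₂ = ballot (suc u) t
  N = 3 + t + 3 * u
  N≡ : t + 3 * suc u ≡ 3 + t + 3 * u
  N≡ = solve (t ∷ u ∷ [])

[2n+1]*ballot[n,1]≡[3n]Cn : ∀ n → suc (2 * n) * ballot n 1 ≡ (3 * n) C n
[2n+1]*ballot[n,1]≡[3n]Cn n = *-cancelˡ-≡ _ _ (suc (3 * n)) (begin
  suc (3 * n) * (suc (2 * n) * ballot n 1)
    ≡⟨ *-leftComm (suc (3 * n)) (suc (2 * n)) (ballot n 1) ⟩
  suc (2 * n) * (suc (3 * n) * ballot n 1)
    ≡⟨ cong (suc (2 * n) *_) (trans (ballot-closed n 1) (*-identityˡ _)) ⟩
  suc (2 * n) * (suc (3 * n) C n)
    ≡⟨ [j+1]*[k+j+1]Ck≡[k+j+1]*[k+j]Ck n (2 * n) ⟩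
  suc (3 * n) * ((3 * n) C n) ∎)

ballot[n,1]≡[3n]Cn/[2n+1] : ∀ n → ballot n 1 ≡ ((3 * n) C n) / suc (2 * n)
ballot[n,1]≡[3n]Cn/[2n+1] n = begin
  ballot n 1
    ≡⟨ m*n/n≡m (ballot n 1) (suc (2 * n)) ⟨
  (ballot n 1 * suc (2 * n)) / suc (2 * n)
    ≡⟨ cong (_/ suc (2 * n)) (trans (*-comm _ (suc (2 * n))) ([2n+1]*ballot[n,1]≡[3n]Cn n)) ⟩
  ((3 * n) C n) / suc (2 * n) ∎

pairWeight : ℕ → ℕ → ℕ
pairWeight r s = (r + s) C r

pairWeight-zeroʳ : ∀ r → pairWeight r 0 ≡ 1
pairWeight-zeroʳ r = trans (cong (_C r) (+-identityʳ r)) (nCn≡1 r)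

hockey-stick : ∀ p s → sumUpTo p (λ q → pairWeight q s) ≡ pairWeight p (suc s)
hockey-stick zero    s = refl
hockey-stick (suc p) s = begin
  sumUpTo p (λ q → pairWeight q s) + (suc p + s) C suc p
    ≡⟨ cong₂ _+_ (hockey-stick p s) (cong (_C suc p) (sym (+-suc p s))) ⟩
  (p + suc s) C p + (p + suc s) C suc p
    ≡⟨ nCk+nC[k+1]≡[n+1]C[k+1] (p + suc s) p ⟩
  suc (p + suc s) C suc p ∎

≤ᵇ-suc : ∀ m n → (suc m ≤ᵇ suc n) ≡ (m ≤ᵇ n)
≤ᵇ-suc zero    n = refl
≤ᵇ-suc (suc m) n = refl

staysAboveᵇ : ℕ → Word → Bool
staysAboveᵇ h w = all (λ u → count y u ≤ᵇ h + count x u) (inits w)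

staysAboveᵇ-x : ∀ h w → staysAboveᵇ h (x ∷ w) ≡ staysAboveᵇ (suc h) w
staysAboveᵇ-x h w = trans (all-inits-∷ (λ u → count y u ≤ᵇ h + count x u) x w)
  (cong and (map-cong (λ u → cong (count y u ≤ᵇ_) (+-suc h (count x u))) (inits w)))

staysAboveᵇ-y : ∀ h w → staysAboveᵇ (suc h) (y ∷ w) ≡ staysAboveᵇ h w
staysAboveᵇ-y h w = trans (all-inits-∷ (λ u → count y u ≤ᵇ suc h + count x u) y w)
  (cong and (map-cong (λ u → ≤ᵇ-suc (count y u) (h + count x u)) (inits w)))

isDyckFromᵇ : ℕ → ℕ → Word → Bool
isDyckFromᵇ h X []      = (h ≡ᵇ 0) ∧ (X ≡ᵇ 0)
isDyckFromᵇ h X (x ∷ w) = (0 <ᵇ X) ∧ isDyckFromᵇ (suc h) (pred X) w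
isDyckFromᵇ h X (y ∷ w) = (0 <ᵇ h) ∧ isDyckFromᵇ (pred h) X w

isDyckFromᵇ-spec : ∀ h X w →
  isDyckFromᵇ h X w ≡ (count x w ≡ᵇ X) ∧ (count y w ≡ᵇ h + X) ∧ staysAboveᵇ h w
isDyckFromᵇ-spec zero    zero    []      = refl
isDyckFromᵇ-spec zero    (suc X) []      = refl
isDyckFromᵇ-spec (suc h) zero    []      = refl
isDyckFromᵇ-spec (suc h) (suc X) []      = refl
isDyckFromᵇ-spec h       zero    (x ∷ w) = refl
isDyckFromᵇ-spec h       (suc X) (x ∷ w) = begin
  isDyckFromᵇ (suc h) X w
    ≡⟨ isDyckFromᵇ-spec (suc h) X w ⟩
  (count x w ≡ᵇ X) ∧ (count y w ≡ᵇ suc h + X) ∧ staysAboveᵇ (suc h) w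
    ≡⟨ cong₂ (λ m b → (count x w ≡ᵇ X) ∧ (count y w ≡ᵇ m) ∧ b)
             (sym (+-suc h X)) (sym (staysAboveᵇ-x h w)) ⟩
  (count x w ≡ᵇ X) ∧ (count y w ≡ᵇ h + suc X) ∧ staysAboveᵇ h (x ∷ w) ∎
isDyckFromᵇ-spec zero    X       (y ∷ w) =
  sym (trans (cong ((count x w ≡ᵇ X) ∧_) (∧-zeroʳ _)) (∧-zeroʳ _))
isDyckFromᵇ-spec (suc h) X       (y ∷ w) =
  trans (isDyckFromᵇ-spec h X w)
        (cong (λ b → (count x w ≡ᵇ X) ∧ (count y w ≡ᵇ h + X) ∧ b) (sym (staysAboveᵇ-y h w)))

isDyckᵇ≡isDyckFromᵇ : ∀ n w → isDyckᵇ n w ≡ isDyckFromᵇ 0 n w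
isDyckᵇ≡isDyckFromᵇ n w = sym (isDyckFromᵇ-spec 0 n w)

isDyckFromᵇ⇒yGaps : ∀ h X w → isDyckFromᵇ (suc h) X w ≡ true →
  ∃[ s ] (∀ d → gapsFrom y d w ≡ d + s ∷ gaps y w)
isDyckFromᵇ⇒yGaps h zero    (x ∷ w) ()
isDyckFromᵇ⇒yGaps h (suc X) (x ∷ w) valid with isDyckFromᵇ⇒yGaps (suc h) X w valid
... | s , yGaps = suc s , λ d → trans (yGaps (suc d)) (cong (_∷ gaps y w) (sym (+-suc d s)))
isDyckFromᵇ⇒yGaps h X       (y ∷ w) _     = 0 , λ d → cong (_∷ gapsFrom y 0 w) (sym (+-identityʳ d))

-- After j y's and k x's: `pending cs o` holds the gaps r_{j+1}, …, r_{k−1} as cs and the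
-- number o of y's read since the k-th x; `none` means j = k.
data Pending : Set where
  none    : Pending
  pending : List ℕ → ℕ → Pending

height : Pending → ℕ
height none           = 0
height (pending cs _) = suc (length cs)

total : Pending → ℕ
total none           = 0
total (pending cs o) = sum cs + o

load : Pending → ℕ
load st = height st + height st + total st

push : Pending → Pending
push none           = pending [] 0
push (pending cs o) = pending (cs ++ o ∷ []) 0

pop : List ℕ → ℕ → ℕ × Pending
pop []       o = suc o , none
pop (c ∷ cs) o = c , pending cs (suc o)

height-push : ∀ st → height (push st) ≡ suc (height st)
height-push none           = refl
height-push (pending cs o) = cong suc (trans (length-++ cs) (+-comm (length cs) 1))

load-push : ∀ st → load (push st) ≡ 2 + load st
load-push st = trans (cong₂ (λ h t → h + h + t) (height-push st) (total-push st))
                     (cong (λ m → suc m + total st) (+-suc (height st) (height st)))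
  where
  total-push : ∀ st → total (push st) ≡ total st
  total-push none           = refl
  total-push (pending cs o) =
    trans (+-identityʳ _) (trans (sum-++ cs (o ∷ [])) (cong (sum cs +_) (+-identityʳ o)))

height-pop : ∀ cs o → height (proj₂ (pop cs o)) ≡ length cs
height-pop []       o = refl
height-pop (c ∷ cs) o = refl

load-pop : ∀ cs o → load (pending cs o) ≡ suc (proj₁ (pop cs o) + load (proj₂ (pop cs o)))
load-pop []       o = cong (λ m → suc (suc m)) (sym (+-identityʳ o))
load-pop (c ∷ cs) o = rearrange (length cs) c (sum cs) o
  where
  rearrange : ∀ l c s o →
    suc (suc l) + suc (suc l) + (c + s + o) ≡ suc (c + (suc l + suc l + (s + suc o)))
  rearrange = solve-∀

xGaps : Pending → Word → List ℕ
xGaps none           w = gaps x w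
xGaps (pending cs o) w = cs ++ gapsFrom x o w

xGaps-push : ∀ st w → xGaps st (x ∷ w) ≡ xGaps (push st) w
xGaps-push none           w = refl
xGaps-push (pending cs o) w = sym (++-assoc cs (o ∷ []) (gapsFrom x 0 w))

-- p stands in for the gap r_j paired with the y-gap s_j being read.
suffixWeight : ℕ → Pending → Word → ℕ
suffixWeight p st w = product (zipWith pairWeight (p ∷ xGaps st w) (gapsFrom y 0 w))

weightFrom : ℕ → Pending → ℕ → Word → ℕ
weightFrom p st X w = if isDyckFromᵇ (height st) X w then suffixWeight p st w else 0

product-zipWith-0∷ : ∀ l d w →
  product (zipWith pairWeight (0 ∷ l) (gapsFrom y d w)) ≡ product (zipWith pairWeight l (gaps y w))
product-zipWith-0∷ l d []      = sym (cong product (zipWith-zeroʳ pairWeight l))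
product-zipWith-0∷ l d (x ∷ w) = product-zipWith-0∷ l (suc d) w
product-zipWith-0∷ l d (y ∷ w) = +-identityʳ _

weight≡suffixWeight : ∀ w → weight w ≡ suffixWeight 0 none w
weight≡suffixWeight w = sym (product-zipWith-0∷ (gaps x w) 0 w)

suffixWeight-x : ∀ p st w {s} → (∀ d → gapsFrom y d w ≡ d + s ∷ gaps y w) →
  sumUpTo p (λ q → suffixWeight q (push st) w) ≡ suffixWeight p st (x ∷ w)
suffixWeight-x p st w {s} yGaps = begin
  sumUpTo p (λ q → suffixWeight q (push st) w)
    ≡⟨ sumUpTo-cong p (λ q → cong (λ g → product (zipWith pairWeight (q ∷ xGaps (push st) w) g))
                                  (yGaps 0)) ⟩
  sumUpTo p (λ q → pairWeight q s * rest)
    ≡⟨ sumUpTo-distribʳ p (λ q → pairWeight q s) rest ⟩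
  sumUpTo p (λ q → pairWeight q s) * rest
    ≡⟨ cong (_* rest) (hockey-stick p s) ⟩
  pairWeight p (suc s) * rest
    ≡⟨ cong₂ (λ l g → product (zipWith pairWeight (p ∷ l) g))
             (sym (xGaps-push st w)) (sym (yGaps 1)) ⟩
  suffixWeight p st (x ∷ w) ∎
  where rest = product (zipWith pairWeight (xGaps (push st) w) (gaps y w))

suffixWeight-y : ∀ p cs o X w → isDyckFromᵇ (length cs) X w ≡ true →
  suffixWeight p (pending cs o) (y ∷ w) ≡ suffixWeight (proj₁ (pop cs o)) (proj₂ (pop cs o)) w
suffixWeight-y p []       o X []      _  = trans (*-identityʳ _) (pairWeight-zeroʳ p)
suffixWeight-y p []       o X (x ∷ w) _  = trans (cong (_* _) (pairWeight-zeroʳ p)) (*-identityˡ _)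
suffixWeight-y p (c ∷ cs) o X w       _  = trans (cong (_* _) (pairWeight-zeroʳ p)) (*-identityˡ _)

weightFrom-x : ∀ p st X w →
  sumUpTo p (λ q → weightFrom q (push st) X w) ≡ weightFrom p st (suc X) (x ∷ w)
weightFrom-x p st X w = begin
  sumUpTo p (λ q → weightFrom q (push st) X w)
    ≡⟨ cong (λ h → sumUpTo p (λ q → if isDyckFromᵇ h X w then suffixWeight q (push st) w else 0))
            (height-push st) ⟩
  sumUpTo p (λ q → if valid then suffixWeight q (push st) w else 0)
    ≡⟨ sumUpTo-if p valid _ ⟩
  (if valid then sumUpTo p (λ q → suffixWeight q (push st) w) else 0)
    ≡⟨ if-congᵗ valid {n = suffixWeight p st (x ∷ w)}
                (λ v → suffixWeight-x p st w (proj₂ (isDyckFromᵇ⇒yGaps (height st) X w v))) ⟩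
  weightFrom p st (suc X) (x ∷ w) ∎
  where valid = isDyckFromᵇ (suc (height st)) X w

weightFrom-y : ∀ p cs o X w →
  weightFrom p (pending cs o) X (y ∷ w) ≡ weightFrom (proj₁ (pop cs o)) (proj₂ (pop cs o)) X w
weightFrom-y p []       o X w = if-congᵗ (isDyckFromᵇ 0 X w) (suffixWeight-y p [] o X w)
weightFrom-y p (c ∷ cs) o X w =
  if-congᵗ (isDyckFromᵇ (suc (length cs)) X w) (suffixWeight-y p (c ∷ cs) o X w)

SumsToBallot : ℕ → ℕ → Set
SumsToBallot L X = ∀ p st → L ≡ X + X + height st →
  sum (map (weightFrom p st X) (words L)) ≡ ballot X (suc (p + load st))

sum-x-words : ∀ {L X} → SumsToBallot L X → ∀ p st → L ≡ X + X + suc (height st) →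
  sum (map (λ w → weightFrom p st (suc X) (x ∷ w)) (words L)) ≡
  sumUpTo p (λ q → ballot X (3 + q + load st))
sum-x-words {L} {X} IH p st e = begin
  sum (map (λ w → weightFrom p st (suc X) (x ∷ w)) (words L))
    ≡⟨ cong sum (map-cong (λ w → sym (weightFrom-x p st X w)) (words L)) ⟩
  sum (map (λ w → sumUpTo p (λ q → weightFrom q (push st) X w)) (words L))
    ≡⟨ sum-map-sumUpTo p (λ q → weightFrom q (push st) X) (words L) ⟩
  sumUpTo p (λ q → sum (map (weightFrom q (push st) X) (words L)))
    ≡⟨ sumUpTo-cong p (λ q → IH q (push st) (trans e (cong (X + X +_) (sym (height-push st))))) ⟩
  sumUpTo p (λ q → ballot X (suc (q + load (push st))))
    ≡⟨ sumUpTo-cong p (λ q → cong (λ m → ballot X (suc m))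
                                  (trans (cong (q +_) (load-push st))
                                         (trans (+-suc q _) (cong suc (+-suc q (load st)))))) ⟩
  sumUpTo p (λ q → ballot X (3 + q + load st)) ∎

sum-y-words : ∀ {L X} → SumsToBallot L X → ∀ p cs o → L ≡ X + X + length cs →
  sum (map (λ w → weightFrom p (pending cs o) X (y ∷ w)) (words L)) ≡ ballot X (load (pending cs o))
sum-y-words {L} {X} IH p cs o e = begin
  sum (map (λ w → weightFrom p (pending cs o) X (y ∷ w)) (words L))
    ≡⟨ cong sum (map-cong (weightFrom-y p cs o X) (words L)) ⟩
  sum (map (weightFrom p′ st′ X) (words L))
    ≡⟨ IH p′ st′ (trans e (cong (X + X +_) (sym (height-pop cs o)))) ⟩
  ballot X (suc (p′ + load st′))
    ≡⟨ cong (ballot X) (sym (load-pop cs o)) ⟩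
  ballot X (load (pending cs o)) ∎
  where
  p′ = proj₁ (pop cs o)
  st′ = proj₂ (pop cs o)

length-after-x : ∀ {L X h} → suc L ≡ suc X + suc X + h → L ≡ X + X + suc h
length-after-x {X = X} {h} e =
  trans (suc-injective e) (trans (cong (_+ h) (+-suc X X)) (sym (+-suc (X + X) h)))

sumWeights : ∀ L X → SumsToBallot L X
sumWeights zero    zero    p none           _ = refl
sumWeights zero    (suc X) p none           ()
sumWeights zero    X       p (pending cs o) e =
  ⊥-elim (1+n≢0 (sym (trans e (+-suc (X + X) (length cs)))))
sumWeights (suc L) zero    p none           ()
sumWeights (suc L) zero    p (pending cs o) e =
  trans (sum-words-suc L _)
        (cong₂ _+_ (sum-map-0 (words L)) (sum-y-words (sumWeights L 0) p cs o (suc-injective e)))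
sumWeights (suc L) (suc X) p none           e =
  trans (sum-words-suc L _)
        (trans (cong₂ _+_ (sum-x-words (sumWeights L X) p none (length-after-x e)) (sum-map-0 (words L)))
               (sym (ballot-unfold X 0 p)))
sumWeights (suc L) (suc X) p st@(pending cs o) e =
  trans (sum-words-suc L _)
        (trans (cong₂ _+_ (sum-x-words (sumWeights L X) p st (length-after-x e))
                          (sum-y-words (sumWeights L (suc X)) p cs o
                             (suc-injective (trans e (+-suc (suc X + suc X) (length cs))))))
               (sym (ballot-unfold X (load st) p)))

-- The identity also holds for n = 0.
corollary4p15 : (n : ℕ) → n ≥ 1 →
    sum (map weight (Dyck n)) ≡ ((3 * n) C n) / suc (2 * n)
corollary4p15 n _ = begin
  sum (map weight (Dyck n))
    ≡⟨ sum-filterᵇ (isDyckᵇ n) weight (words (n + n)) ⟩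
  sum (map (λ w → if isDyckᵇ n w then weight w else 0) (words (n + n)))
    ≡⟨ cong sum (map-cong (λ w → cong₂ (λ b v → if b then v else 0)
                                       (isDyckᵇ≡isDyckFromᵇ n w) (weight≡suffixWeight w))
                          (words (n + n))) ⟩
  sum (map (weightFrom 0 none n) (words (n + n)))
    ≡⟨ sumWeights (n + n) n 0 none (sym (+-identityʳ (n + n))) ⟩
  ballot n 1
    ≡⟨ ballot[n,1]≡[3n]Cn/[2n+1] n ⟩
  ((3 * n) C n) / suc (2 * n) ∎
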